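{- Let $m \geq 2$ be an integer and let $d_i(m)$, $0\le i\le m$, be the Boros-Moll coefficients. Then \[ \frac{d_m(m)}{d_0(m)}<\frac{d_{m-1}(m)}{d_1(m)}< \cdots <\frac{d_{m-i}(m)}{d_i(m)}<\frac{d_{m-i-1}(m)}{d_{i+1}(m)}<\cdots <\frac{d_{m-\lfloor\frac{m-1}{2}\rfloor}(m)}{d_{\lfloor\frac{m-1}{2}\rfloor}(m)}<1 \] and \[ \frac{d_0(m)}{d_{m-1}(m)}<\frac{d_1(m)}{d_{m-2}(m)}<\cdots<\frac{d_{i-1}(m)}{d_{m-i}(m)}<\frac{d_i(m)}{d_{m-i-1}(m)}<\cdots<\frac{d_{\lfloor\frac{m}{2}\rfloor-1}(m)}{d_{m-\lfloor\frac{m}{2}\rfloor}(m)}<1. \] That is, the sequence $\{d_i(m)\}_{0\le i\le m}$ is strictly ratio monotone.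
   Context: For a nonnegative integer $m$ and $0\le i\le m$, the Boros-Moll coefficients are \[ d_i(m)=2^{ -2m}\sum_{k=i}^m 2^k\binom{2m-2k}{m-k}\binom{m+k}{k}\binom{k}{i}, \] so that $P_m(a)=\sum_{i=0}^m d_i(m)a^i = 2^{ -2m}\sum_k 2^k\binom{2m-2k}{m-k}\binom{m+k}{k}(a+1)^k$. A sequence $\{a_i\}_{0\le i\le m}$ of positive numbers is strictly ratio monotone if $\frac{a_0}{a_{m-1}}<\frac{a_1}{a_{m-2}}<\cdots<\frac{a_{\lfloor m/2\rfloor-1}}{a_{m-\lfloor m/2\rfloor}}<1$ and $\frac{a_m}{a_0}<\frac{a_{m-1}}{a_1}<\cdots<\frac{a_{m-\lfloor (m-1)/2\rfloor}}{a_{\lfloor (m-1)/2\rfloor}}<1$. Here $\lfloor x\rfloor$ is the integer part of $x$. -}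

module Defs where

open import Data.Nat as ℕ using (ℕ; zero; suc; _∸_; _^_; _+_; _*_; _/_)
open import Data.Nat.Combinatorics using (_C_)
open import Data.Integer using (+_)
open import Data.Rational as ℚ using (ℚ; Positive; NonZero; _÷_; _<_; 1ℚ)
open import Data.Rational.Properties using (pos⇒nonZero)
open import Relation.Binary.PropositionalEquality using (_≡_)
open import Data.List using (List; map; upTo)
open import Data.Nat.ListAction using (sum)
open import Data.Product using (Σ)
import Data.Nat.Properties as NP

sumFromTo : ℕ → ℕ → (ℕ → ℕ) → ℕ
sumFromTo i m f = sum (map (λ j → f (i + j)) (upTo (suc m ∸ i)))

-- Boros–Moll coefficient d_i(m) = 2^{-2m} Σ_{k=i}^m 2^k C(2m-2k,m-k) C(m+k,k) C(k,i)
bmNum : ℕ → ℕ → ℕ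
bmNum m i = sumFromTo i m (λ k → 2 ^ k * ((2 * m ∸ 2 * k) C (m ∸ k)) * ((m + k) C k) * (k C i))

d : ℕ → ℕ → ℚ
d m i = ℚ._/_ (+ bmNum m i) (2 ^ (2 * m)) {{ℕ.>-nonZero (NP.m^n>0 2 (2 * m))}}

AllPositive : ℕ → (ℕ → ℚ) → Set
AllPositive m a = ∀ i → i ℕ.≤ m → Positive (a i)

ratio : (a : ℕ → ℚ) (j k : ℕ) → Positive (a k) → ℚ
ratio a j k pk = (a j ÷ a k) {{pos⇒nonZero (a k) {{pk}}}}

module _ (m : ℕ) (a : ℕ → ℚ) (positive : AllPositive m a) where
  -- first chain, i ranges over 0 ≤ i ≤ ⌊m/2⌋ - 1 ; term r₁ i = a_i / a_{m-1-i}
  r₁ : (i : ℕ) → ℚ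
  r₁ i = ratio a i (m ∸ 1 ∸ i) (positive (m ∸ 1 ∸ i) (NP.≤-trans (NP.m∸n≤m (m ∸ 1) i) (NP.m∸n≤m m 1)))
  -- second chain, i ranges over 0 ≤ i ≤ ⌊(m-1)/2⌋ ; term r₂ i = a_{m-i} / a_i
  r₂ : (i : ℕ) → i ℕ.≤ m → ℚ
  r₂ i i≤m = ratio a (m ∸ i) i (positive i i≤m)

  record RatioChains : Set where
    field
      chain₁ : ∀ i → suc (suc i) ℕ.≤ m / 2 → r₁ i < r₁ (suc i)
      last₁  : ∀ i → suc i ≡ m / 2 → r₁ i < 1ℚ
      chain₂ : ∀ i → (p : i ℕ.≤ m) (q : suc i ℕ.≤ m) → suc i ℕ.≤ (m ∸ 1) / 2 → r₂ i p < r₂ (suc i) q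
      last₂  : ∀ i → (p : i ℕ.≤ m) → i ≡ (m ∸ 1) / 2 → r₂ i p < 1ℚ

StrictlyRatioMonotone : ℕ → (ℕ → ℚ) → Set
StrictlyRatioMonotone m a = Σ (AllPositive m a) (RatioChains m a)

-- Up to the factor 2^(2m), d_l(m) is the binomial transform
-- b_l = Σ_{k≤m} c_k C(k,l) of the weights c_k = 2^k C(2m-2k,m-k) C(m+k,k), which
-- are positive and strictly increasing: with v = m-k-1 one has
-- c_{k+1}/c_k = (v+1)(m+k+1) / ((2v+1)(k+1)) > 1.
-- Since k C(k,l) = (l+1) C(k,l+1) + l C(k,l), we get m b_l = T_l + (l+1) b_{l+1} + l b_l
-- with T_l = Σ_k c_k (m-k) C(k,l) > 0, and Abel summation together with the
-- hockey-stick identity gives T_l < b_{l+1} for increasing weights. Hence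
--   (l+1) b_{l+1} < (m-l) b_l < (l+2) b_{l+1}.
-- Multiplying these bounds at l = i and at the mirror index gives
-- b_i b_j < b_{i+1} b_{j+1} when i+j+2 = m and b_{i+1} b_{j+1} < b_i b_j when i+j+1 = m,
-- which are the two chains of ratios after cross-multiplication; the last links are the
-- cases j = i and j = i+1.

module Submission where

open import Data.Nat
open import Data.Nat.Properties
open import Data.Nat.Combinatorics using (_C_; nCn≡1; nC1≡n; nCk≡nC[n∸k]; nCk+nC[k+1]≡[n+1]C[k+1]; k>n⇒nCk≡0)
open import Data.Nat.DivMod using (_/_; _%_; m%n<n; m≡m%n+[m/n]*n; m/n≤m)
open import Data.Nat.ListAction using (sum)
open import Data.Nat.Solver using (module +-*-Solver)
open import Data.List using (map; applyUpTo; upTo)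
open import Data.Sum using (_⊎_; inj₁; inj₂)
open import Data.Product using (_,_)
open import Function using (_∘_)
open import Relation.Nullary using (yes; no; contradiction)
open import Relation.Binary.PropositionalEquality
open +-*-Solver

open import Defs

module Fractions where

  open import Data.Integer as ℤ using (+_)
  import Data.Integer.Properties as ℤ
  open import Data.Rational as ℚ using (ℚ; fromℚᵘ)
  import Data.Rational.Properties as ℚ
  import Data.Rational.Unnormalised as ℚᵘ
  import Data.Rational.Unnormalised.Properties as ℚᵘ

  fromℚᵘ-mono-< : ∀ {p q} → p ℚᵘ.< q → fromℚᵘ p ℚ.< fromℚᵘ q
  fromℚᵘ-mono-< {p} {q} p<q = ℚ.toℚᵘ-cancel-<
    (ℚᵘ.<-respˡ-≃ (ℚᵘ.≃-sym (ℚ.toℚᵘ-fromℚᵘ p)) (ℚᵘ.<-respʳ-≃ (ℚᵘ.≃-sym (ℚ.toℚᵘ-fromℚᵘ q)) p<q))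

  fromℚᵘ-homo-* : ∀ p q → fromℚᵘ (p ℚᵘ.* q) ≡ fromℚᵘ p ℚ.* fromℚᵘ q
  fromℚᵘ-homo-* p q = sym (trans (sym (ℚ.fromℚᵘ-toℚᵘ _)) (ℚ.fromℚᵘ-cong
    (ℚᵘ.≃-trans (ℚ.toℚᵘ-homo-* (fromℚᵘ p) (fromℚᵘ q)) (ℚᵘ.*-cong (ℚ.toℚᵘ-fromℚᵘ p) (ℚ.toℚᵘ-fromℚᵘ q)))))

  mkℚᵘ-mono-< : ∀ {m n} d → m ℤ.< n → ℚᵘ.mkℚᵘ m d ℚᵘ.< ℚᵘ.mkℚᵘ n d
  mkℚᵘ-mono-< d m<n = ℚᵘ.*<* (ℤ.*-monoʳ-<-pos (+ suc d) m<n)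

  -- + n / suc d unfolds to fromℚᵘ (mkℚᵘ (+ n) d), so comparisons at a fixed denominator happen in ℚᵘ.
  /-mono-< : ∀ d .{{_ : NonZero d}} {m n} → m < n → + m ℚ./ d ℚ.< + n ℚ./ d
  /-mono-< (suc d-1) m<n = fromℚᵘ-mono-< (mkℚᵘ-mono-< d-1 (ℤ.+<+ m<n))

  /-*-/-mono-< : ∀ d .{{_ : NonZero d}} {a b c e} → a * b < c * e →
                 (+ a ℚ./ d) ℚ.* (+ b ℚ./ d) ℚ.< (+ c ℚ./ d) ℚ.* (+ e ℚ./ d)
  /-*-/-mono-< (suc d-1) {a} {b} {c} {e} ab<ce = subst₂ ℚ._<_
    (fromℚᵘ-homo-* (ℚᵘ.mkℚᵘ (+ a) d-1) (ℚᵘ.mkℚᵘ (+ b) d-1))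
    (fromℚᵘ-homo-* (ℚᵘ.mkℚᵘ (+ c) d-1) (ℚᵘ.mkℚᵘ (+ e) d-1))
    (fromℚᵘ-mono-< (mkℚᵘ-mono-< _ (subst₂ ℤ._<_ (ℤ.pos-* a b) (ℤ.pos-* c e) (ℤ.+<+ ab<ce))))

  /-pos : ∀ d .{{_ : NonZero d}} {n} → 0 < n → ℚ.Positive (+ n ℚ./ d)
  /-pos d {{d≢0}} {n} 0<n = ℚ.normalize-pos n d {{d≢0}} {{>-nonZero 0<n}}

  ÷-*-cancel : ∀ x y w .{{_ : ℚ.NonZero y}} → (x ℚ.÷ y) ℚ.* (y ℚ.* w) ≡ x ℚ.* w
  ÷-*-cancel x y w = begin
    x ℚ.* ℚ.1/ y ℚ.* (y ℚ.* w)     ≡⟨ ℚ.*-assoc x (ℚ.1/ y) (y ℚ.* w) ⟩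
    x ℚ.* (ℚ.1/ y ℚ.* (y ℚ.* w))   ≡⟨ cong (x ℚ.*_) (ℚ.*-assoc (ℚ.1/ y) y w) ⟨
    x ℚ.* (ℚ.1/ y ℚ.* y ℚ.* w)     ≡⟨ cong (λ t → x ℚ.* (t ℚ.* w)) (ℚ.*-inverseˡ y) ⟩
    x ℚ.* (ℚ.1ℚ ℚ.* w)             ≡⟨ cong (x ℚ.*_) (ℚ.*-identityˡ w) ⟩
    x ℚ.* w                        ∎
    where open ≡-Reasoning

  ÷-<-÷ : ∀ x y z w .{{_ : ℚ.Positive y}} .{{_ : ℚ.Positive w}} → x ℚ.* w ℚ.< z ℚ.* y →
          (x ℚ.÷ y) {{ℚ.pos⇒nonZero y}} ℚ.< (z ℚ.÷ w) {{ℚ.pos⇒nonZero w}}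
  ÷-<-÷ x y z w xw<zy = ℚ.*-cancelʳ-<-nonNeg (y ℚ.* w) {{ℚ.pos⇒nonNeg (y ℚ.* w) {{ℚ.pos*pos⇒pos y w}}}}
    (subst₂ ℚ._<_ (sym (÷-*-cancel x y w {{ℚ.pos⇒nonZero y}}))
                  (sym (trans (cong ((z ℚ.÷ w) {{ℚ.pos⇒nonZero w}} ℚ.*_) (ℚ.*-comm y w)) (÷-*-cancel z w y {{ℚ.pos⇒nonZero w}})))
                  xw<zy)

  module FixedDenominator (n : ℕ → ℕ) (D : ℕ) .{{D≢0 : NonZero D}} where

    a : ℕ → ℚ
    a i = + n i ℚ./ D

    a>0 : ∀ i → 0 < n i → ℚ.Positive (a i)
    a>0 i = /-pos D

    ratio-<-ratio : ∀ i j k l (pj : ℚ.Positive (a j)) (pl : ℚ.Positive (a l)) →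
                    n i * n l < n k * n j → ratio a i j pj ℚ.< ratio a k l pl
    ratio-<-ratio i j k l pj pl nᵢnₗ<nₖnⱼ =
      ÷-<-÷ (a i) (a j) (a k) (a l) {{pj}} {{pl}} (/-*-/-mono-< D {n i} {n l} {n k} {n j} nᵢnₗ<nₖnⱼ)

    ratio<1 : ∀ i j (pj : ℚ.Positive (a j)) → n i < n j → ratio a i j pj ℚ.< ℚ.1ℚ
    ratio<1 i j pj nᵢ<nⱼ = subst (ratio a i j pj ℚ.<_) (ℚ.*-inverseʳ (a j) {{ℚ.pos⇒nonZero (a j) {{pj}}}})
      (÷-<-÷ (a i) (a j) (a j) (a j) {{pj}} {{pj}} (ℚ.*-monoˡ-<-pos (a j) {{pj}} (/-mono-< D nᵢ<nⱼ)))

open ≤-Reasoning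

-- Finite sums

∑ : ℕ → (ℕ → ℕ) → ℕ
∑ zero    f = 0
∑ (suc n) f = ∑ n f + f n

∑-cong : ∀ n {f g} → (∀ {k} → k < n → f k ≡ g k) → ∑ n f ≡ ∑ n g
∑-cong zero    f≗g = refl
∑-cong (suc n) f≗g = cong₂ _+_ (∑-cong n (f≗g ∘ m<n⇒m<1+n)) (f≗g ≤-refl)

∑-zero : ∀ n {f} → (∀ {k} → k < n → f k ≡ 0) → ∑ n f ≡ 0
∑-zero zero    f≗0 = refl
∑-zero (suc n) f≗0 = cong₂ _+_ (∑-zero n (f≗0 ∘ m<n⇒m<1+n)) (f≗0 ≤-refl)

∑-distrib-+ : ∀ n f g → ∑ n (λ k → f k + g k) ≡ ∑ n f + ∑ n g
∑-distrib-+ zero    f g = refl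
∑-distrib-+ (suc n) f g rewrite ∑-distrib-+ n f g =
  solve 4 (λ a b c d → a :+ b :+ (c :+ d) := a :+ c :+ (b :+ d)) refl (∑ n f) (∑ n g) (f n) (g n)

*-distribˡ-∑ : ∀ n a f → a * ∑ n f ≡ ∑ n (λ k → a * f k)
*-distribˡ-∑ zero    a f = *-zeroʳ a
*-distribˡ-∑ (suc n) a f rewrite sym (*-distribˡ-∑ n a f) = *-distribˡ-+ a (∑ n f) (f n)

∑-mono-≤ : ∀ n {f g} → (∀ {k} → k < n → f k ≤ g k) → ∑ n f ≤ ∑ n g
∑-mono-≤ zero    f≤g = z≤n
∑-mono-≤ (suc n) f≤g = +-mono-≤ (∑-mono-≤ n (f≤g ∘ m<n⇒m<1+n)) (f≤g ≤-refl)

∑-mono-< : ∀ n {f g} → (∀ {k} → k < n → f k ≤ g k) → ∀ {j} → j < n → f j < g j → ∑ n f < ∑ n g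
∑-mono-< (suc n) f≤g j<1+n fj<gj with m<1+n⇒m<n∨m≡n j<1+n
... | inj₁ j<n  = +-mono-<-≤ (∑-mono-< n (f≤g ∘ m<n⇒m<1+n) j<n fj<gj) (f≤g ≤-refl)
... | inj₂ refl = +-mono-≤-< (∑-mono-≤ n (f≤g ∘ m<n⇒m<1+n)) fj<gj

∑-pos : ∀ n {f j} → j < n → 0 < f j → 0 < ∑ n f
∑-pos n j<n 0<fj = subst (_< ∑ n _) (∑-zero n (λ _ → refl)) (∑-mono-< n (λ _ → z≤n) j<n 0<fj)

∑-+ : ∀ i n f → ∑ (i + n) f ≡ ∑ i f + ∑ n (λ j → f (i + j))
∑-+ i zero    f rewrite +-identityʳ i = sym (+-identityʳ (∑ i f))
∑-+ i (suc n) f rewrite +-suc i n | ∑-+ i n f = +-assoc (∑ i f) _ _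

sum-map-applyUpTo : ∀ n (f g : ℕ → ℕ) → sum (map f (applyUpTo g n)) ≡ ∑ n (f ∘ g)
sum-map-applyUpTo zero    f g = refl
sum-map-applyUpTo (suc n) f g = begin-equality
  f (g 0) + sum (map f (applyUpTo (g ∘ suc) n)) ≡⟨ cong (f (g 0) +_) (sum-map-applyUpTo n f (g ∘ suc)) ⟩
  f (g 0) + ∑ n (f ∘ g ∘ suc)                   ≡⟨ ∑-+ 1 n (f ∘ g) ⟨
  ∑ (suc n) (f ∘ g)                             ∎

sumFromTo≡∑ : ∀ i n f → (∀ {k} → k < i → f k ≡ 0) → sumFromTo i n f ≡ ∑ (suc n) f
sumFromTo≡∑ i n f f≗0 with i ≤? suc n
... | yes i≤1+n = begin-equality
  sumFromTo i n f                          ≡⟨ sum-map-applyUpTo (suc n ∸ i) (λ j → f (i + j)) (λ j → j) ⟩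
  ∑ (suc n ∸ i) (λ j → f (i + j))          ≡⟨ cong (_+ ∑ (suc n ∸ i) (λ j → f (i + j))) (∑-zero i f≗0) ⟨
  ∑ i f + ∑ (suc n ∸ i) (λ j → f (i + j))  ≡⟨ ∑-+ i (suc n ∸ i) f ⟨
  ∑ (i + (suc n ∸ i)) f                    ≡⟨ cong (λ k → ∑ k f) (m+[n∸m]≡n i≤1+n) ⟩
  ∑ (suc n) f                              ∎
... | no  i≰1+n = begin-equality
  sumFromTo i n f                          ≡⟨ cong (λ l → sum (map (λ j → f (i + j)) (upTo l))) (m≤n⇒m∸n≡0 (<⇒≤ 1+n<i)) ⟩
  0                                        ≡⟨ ∑-zero (suc n) (λ k<1+n → f≗0 (<-trans k<1+n 1+n<i)) ⟨
  ∑ (suc n) f                              ∎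
  where
  1+n<i = ≰⇒> i≰1+n

-- Binomial coefficients

pascal : ∀ n k → suc n C suc k ≡ n C k + n C suc k
pascal n k = sym (nCk+nC[k+1]≡[n+1]C[k+1] n k)

0C[1+k]≡0 : ∀ k → 0 C suc k ≡ 0
0C[1+k]≡0 k = k>n⇒nCk≡0 {0} {suc k} (s≤s z≤n)

[1+k]*[1+n]C[1+k]≡[1+n]*nCk : ∀ n k → suc k * (suc n C suc k) ≡ suc n * (n C k)
[1+k]*[1+n]C[1+k]≡[1+n]*nCk zero    zero    = refl
[1+k]*[1+n]C[1+k]≡[1+n]*nCk zero    (suc k) rewrite 0C[1+k]≡0 k | 0C[1+k]≡0 (suc k) = *-zeroʳ (suc (suc k))
[1+k]*[1+n]C[1+k]≡[1+n]*nCk (suc n) zero    rewrite nC1≡n (suc (suc n)) = trans (+-identityʳ _) (sym (*-identityʳ (suc (suc n))))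
[1+k]*[1+n]C[1+k]≡[1+n]*nCk (suc n) (suc k) = begin-equality
  2+k * (2+n C 2+k)                               ≡⟨ cong (2+k *_) (pascal (suc n) (suc k)) ⟩
  2+k * (1+n C 1+k + 1+n C 2+k)                    ≡⟨ solve 3 (λ k x y → (con 2 :+ k) :* (x :+ y) := (con 1 :+ k) :* x :+ x :+ (con 2 :+ k) :* y) refl k (1+n C 1+k) (1+n C 2+k) ⟩
  1+k * (1+n C 1+k) + 1+n C 1+k + 2+k * (1+n C 2+k) ≡⟨ cong₂ (λ a b → a + 1+n C 1+k + b) ([1+k]*[1+n]C[1+k]≡[1+n]*nCk n k) ([1+k]*[1+n]C[1+k]≡[1+n]*nCk n (suc k)) ⟩
  1+n * (n C k) + 1+n C 1+k + 1+n * (n C 1+k)      ≡⟨ solve 4 (λ n x y z → (con 1 :+ n) :* x :+ z :+ (con 1 :+ n) :* y := (con 1 :+ n) :* (x :+ y) :+ z) refl n (n C k) (n C 1+k) (1+n C 1+k) ⟩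
  1+n * (n C k + n C 1+k) + 1+n C 1+k              ≡⟨ cong (λ a → 1+n * a + 1+n C 1+k) (pascal n k) ⟨
  1+n * (1+n C 1+k) + 1+n C 1+k                    ≡⟨ solve 2 (λ n x → (con 1 :+ n) :* x :+ x := (con 2 :+ n) :* x) refl n (1+n C 1+k) ⟩
  2+n * (1+n C 1+k)                               ∎
  where
  1+n = suc n
  2+n = suc (suc n)
  1+k = suc k
  2+k = suc (suc k)

[1+k]*nC[1+k]+k*nCk≡n*nCk : ∀ n k → suc k * (n C suc k) + k * (n C k) ≡ n * (n C k)
[1+k]*nC[1+k]+k*nCk≡n*nCk zero    zero    = refl
[1+k]*nC[1+k]+k*nCk≡n*nCk zero    (suc k) rewrite 0C[1+k]≡0 k | 0C[1+k]≡0 (suc k) | *-zeroʳ k = refl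
[1+k]*nC[1+k]+k*nCk≡n*nCk (suc n) zero    rewrite nC1≡n (suc n) = trans (+-identityʳ _) (trans (+-identityʳ _) (sym (*-identityʳ (suc n))))
[1+k]*nC[1+k]+k*nCk≡n*nCk (suc n) (suc k) = begin-equality
  suc (suc k) * (suc n C suc (suc k)) + suc k * (suc n C suc k) ≡⟨ cong₂ _+_ ([1+k]*[1+n]C[1+k]≡[1+n]*nCk n (suc k)) ([1+k]*[1+n]C[1+k]≡[1+n]*nCk n k) ⟩
  suc n * (n C suc k) + suc n * (n C k)                         ≡⟨ solve 3 (λ n x y → (con 1 :+ n) :* y :+ (con 1 :+ n) :* x := (con 1 :+ n) :* (x :+ y)) refl n (n C k) (n C suc k) ⟩
  suc n * (n C k + n C suc k)                                   ≡⟨ cong (suc n *_) (pascal n k) ⟨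
  suc n * (suc n C suc k)                                       ∎

k≤n⇒nCk>0 : ∀ {n k} → k ≤ n → 0 < n C k
k≤n⇒nCk>0 {n}     {zero}  _         = s≤s z≤n
k≤n⇒nCk>0 {suc n} {suc k} (s≤s k≤n) rewrite pascal n k = <-≤-trans (k≤n⇒nCk>0 k≤n) (m≤m+n (n C k) (n C suc k))

∑[i≤n]iCk≡[1+n]C[1+k] : ∀ n k → ∑ (suc n) (λ i → i C k) ≡ suc n C suc k
∑[i≤n]iCk≡[1+n]C[1+k] zero    k = sym (trans (pascal 0 k) (trans (cong (0 C k +_) (0C[1+k]≡0 k)) (+-identityʳ _)))
∑[i≤n]iCk≡[1+n]C[1+k] (suc n) k = begin-equality
  ∑ (suc n) (λ i → i C k) + suc n C k ≡⟨ cong (_+ suc n C k) (∑[i≤n]iCk≡[1+n]C[1+k] n k) ⟩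
  suc n C suc k + suc n C k           ≡⟨ +-comm (suc n C suc k) (suc n C k) ⟩
  suc n C k + suc n C suc k           ≡⟨ pascal (suc n) k ⟨
  suc (suc n) C suc k                 ∎

-- Binomial transforms of increasing weights

l+1+r≡n⇒l<n : ∀ {l r n} → l + suc r ≡ n → l < n
l+1+r≡n⇒l<n {l} refl = m<m+n l (s≤s z≤n)

StrictlyIncreasingUpTo : ℕ → (ℕ → ℕ) → Set
StrictlyIncreasingUpTo m c = ∀ {j k} → j < k → k ≤ m → c j < c k

strictlyIncreasing-by-steps : ∀ {m c} → (∀ {k} → k < m → c k < c (suc k)) → StrictlyIncreasingUpTo m c
strictlyIncreasing-by-steps step {j} {suc k} (s≤s j≤k) 1+k≤m with m≤n⇒m<n∨m≡n j≤k
... | inj₁ j<k  = <-trans (strictlyIncreasing-by-steps step j<k (<⇒≤ 1+k≤m)) (step 1+k≤m)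
... | inj₂ refl = step 1+k≤m

module BinomialTransform (c : ℕ → ℕ) where

  B : ℕ → ℕ → ℕ
  B n l = ∑ (suc n) (λ k → c k * (k C l))

  Tail : ℕ → ℕ → ℕ
  Tail n l = ∑ (suc n) (λ k → c k * ((n ∸ k) * (k C l)))

  moment : ∀ n l → ∑ (suc n) (λ k → c k * (k * (k C l))) ≡ suc l * B n (suc l) + l * B n l
  moment n l = begin-equality
    ∑ (suc n) (λ k → c k * (k * (k C l)))                                  ≡⟨ ∑-cong (suc n) (λ {k} _ → termwise k) ⟩
    ∑ (suc n) (λ k → suc l * (c k * (k C suc l)) + l * (c k * (k C l)))    ≡⟨ ∑-distrib-+ (suc n) _ _ ⟩
    ∑ (suc n) (λ k → suc l * (c k * (k C suc l))) + ∑ (suc n) (λ k → l * (c k * (k C l)))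
      ≡⟨ cong₂ _+_ (*-distribˡ-∑ (suc n) (suc l) _) (*-distribˡ-∑ (suc n) l _) ⟨
    suc l * B n (suc l) + l * B n l                                        ∎
    where
    termwise : ∀ k → c k * (k * (k C l)) ≡ suc l * (c k * (k C suc l)) + l * (c k * (k C l))
    termwise k = begin-equality
      c k * (k * (k C l))                                 ≡⟨ cong (c k *_) ([1+k]*nC[1+k]+k*nCk≡n*nCk k l) ⟨
      c k * (suc l * (k C suc l) + l * (k C l))            ≡⟨ solve 4 (λ l x y z → x :* ((con 1 :+ l) :* y :+ l :* z) := (con 1 :+ l) :* (x :* y) :+ l :* (x :* z)) refl l (c k) (k C suc l) (k C l) ⟩
      suc l * (c k * (k C suc l)) + l * (c k * (k C l))    ∎

  n*B≡Tail+moment : ∀ n l → n * B n l ≡ Tail n l + (suc l * B n (suc l) + l * B n l)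
  n*B≡Tail+moment n l = begin-equality
    n * B n l                                                            ≡⟨ *-distribˡ-∑ (suc n) n _ ⟩
    ∑ (suc n) (λ k → n * (c k * (k C l)))                                ≡⟨ ∑-cong (suc n) termwise ⟩
    ∑ (suc n) (λ k → c k * ((n ∸ k) * (k C l)) + c k * (k * (k C l)))    ≡⟨ ∑-distrib-+ (suc n) _ _ ⟩
    Tail n l + ∑ (suc n) (λ k → c k * (k * (k C l)))                     ≡⟨ cong (Tail n l +_) (moment n l) ⟩
    Tail n l + (suc l * B n (suc l) + l * B n l)                         ∎
    where
    termwise : ∀ {k} → k < suc n → n * (c k * (k C l)) ≡ c k * ((n ∸ k) * (k C l)) + c k * (k * (k C l))
    termwise {k} (s≤s k≤n) = begin-equality
      n * (c k * (k C l))                                  ≡⟨ cong (_* (c k * (k C l))) (m∸n+n≡m k≤n) ⟨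
      (n ∸ k + k) * (c k * (k C l))                        ≡⟨ solve 4 (λ a b x y → (a :+ b) :* (x :* y) := x :* (a :* y) :+ x :* (b :* y)) refl (n ∸ k) k (c k) (k C l) ⟩
      c k * ((n ∸ k) * (k C l)) + c k * (k * (k C l))      ∎

  Tail>0 : ∀ {n l} → l < n → 0 < c l → 0 < Tail n l
  Tail>0 {n} {l} l<n 0<cl = ∑-pos (suc n) (m<n⇒m<1+n l<n) 0<term
    where
    0<term : 0 < c l * ((n ∸ l) * (l C l))
    0<term rewrite nCn≡1 l | *-identityʳ (n ∸ l) = *-mono-< 0<cl (m<n⇒0<n∸m l<n)

  Tail-suc : ∀ n l → Tail (suc n) l ≡ Tail n l + B n l
  Tail-suc n l = begin-equality
    Tail (suc n) l                                                 ≡⟨ cong (∑ (suc n) f +_) last≡0 ⟩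
    ∑ (suc n) f + 0                                                ≡⟨ +-identityʳ _ ⟩
    ∑ (suc n) f                                                    ≡⟨ ∑-cong (suc n) termwise ⟩
    ∑ (suc n) (λ k → c k * ((n ∸ k) * (k C l)) + c k * (k C l))    ≡⟨ ∑-distrib-+ (suc n) _ _ ⟩
    Tail n l + B n l                                               ∎
    where
    f : ℕ → ℕ
    f k = c k * ((suc n ∸ k) * (k C l))
    last≡0 : c (suc n) * ((n ∸ n) * (suc n C l)) ≡ 0
    last≡0 rewrite n∸n≡0 n = *-zeroʳ (c (suc n))
    termwise : ∀ {k} → k < suc n → c k * ((suc n ∸ k) * (k C l)) ≡ c k * ((n ∸ k) * (k C l)) + c k * (k C l)
    termwise {k} (s≤s k≤n) rewrite +-∸-assoc 1 k≤n =
      solve 3 (λ x a y → x :* ((con 1 :+ a) :* y) := x :* (a :* y) :+ x :* y) refl (c k) (n ∸ k) (k C l)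

  lower-bound : ∀ {n l} r → l + suc r ≡ n → 0 < c l → suc l * B n (suc l) < suc r * B n l
  lower-bound {n} {l} r l+1+r≡n 0<cl = +-cancelˡ-< (l * B n l) _ _ (begin-strict
    l * B n l + suc l * B n (suc l)              ≡⟨ +-comm (l * B n l) _ ⟩
    suc l * B n (suc l) + l * B n l              <⟨ m<n+m _ (Tail>0 l<n 0<cl) ⟩
    Tail n l + (suc l * B n (suc l) + l * B n l) ≡⟨ n*B≡Tail+moment n l ⟨
    n * B n l                                    ≡⟨ cong (_* B n l) l+1+r≡n ⟨
    (l + suc r) * B n l                          ≡⟨ *-distribʳ-+ (B n l) l (suc r) ⟩
    l * B n l + suc r * B n l                    ∎)
    where
    l<n = l+1+r≡n⇒l<n l+1+r≡n

  module _ {m} (increasing : StrictlyIncreasingUpTo m c) (l : ℕ) where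

    ∑[k≤n]c[1+n]kCl≡c[1+n][1+n]C[1+l] : ∀ n → ∑ (suc n) (λ k → c (suc n) * (k C l)) ≡ c (suc n) * (suc n C suc l)
    ∑[k≤n]c[1+n]kCl≡c[1+n][1+n]C[1+l] n = trans (sym (*-distribˡ-∑ (suc n) (c (suc n)) _)) (cong (c (suc n) *_) (∑[i≤n]iCk≡[1+n]C[1+k] n l))

    B≤c[1+n][1+n]C[1+l] : ∀ {n} → suc n ≤ m → B n l ≤ c (suc n) * (suc n C suc l)
    B≤c[1+n][1+n]C[1+l] {n} 1+n≤m = subst (B n l ≤_) (∑[k≤n]c[1+n]kCl≡c[1+n][1+n]C[1+l] n)
      (∑-mono-≤ (suc n) (λ k<1+n → *-monoˡ-≤ _ (<⇒≤ (increasing k<1+n 1+n≤m))))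

    B<c[1+n][1+n]C[1+l] : ∀ {n} → l ≤ n → suc n ≤ m → B n l < c (suc n) * (suc n C suc l)
    B<c[1+n][1+n]C[1+l] {n} l≤n 1+n≤m = subst (B n l <_) (∑[k≤n]c[1+n]kCl≡c[1+n][1+n]C[1+l] n)
      (∑-mono-< (suc n) (λ k<1+n → *-monoˡ-≤ _ (<⇒≤ (increasing k<1+n 1+n≤m))) (s≤s l≤n) c[l]<c[1+n])
      where
      c[l]<c[1+n] : c l * (l C l) < c (suc n) * (l C l)
      c[l]<c[1+n] rewrite nCn≡1 l = *-monoˡ-< 1 (increasing (s≤s l≤n) 1+n≤m)

    Tail≤B : ∀ {n} → n ≤ m → Tail n l ≤ B n (suc l)
    Tail≤B {zero}  _     rewrite *-zeroʳ (c 0) = z≤n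
    Tail≤B {suc n} 1+n≤m rewrite Tail-suc n l = +-mono-≤ (Tail≤B (<⇒≤ 1+n≤m)) (B≤c[1+n][1+n]C[1+l] 1+n≤m)

    Tail<B : ∀ {n} → l < n → n ≤ m → Tail n l < B n (suc l)
    Tail<B {suc n} (s≤s l≤n) 1+n≤m rewrite Tail-suc n l = +-mono-≤-< (Tail≤B (<⇒≤ 1+n≤m)) (B<c[1+n][1+n]C[1+l] l≤n 1+n≤m)

  upper-bound : ∀ {n l} r → StrictlyIncreasingUpTo n c → l + suc r ≡ n → suc r * B n l < suc (suc l) * B n (suc l)
  upper-bound {n} {l} r increasing l+1+r≡n = +-cancelˡ-< (l * B n l) _ _ (begin-strict
    l * B n l + suc r * B n l                    ≡⟨ *-distribʳ-+ (B n l) l (suc r) ⟨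
    (l + suc r) * B n l                          ≡⟨ cong (_* B n l) l+1+r≡n ⟩
    n * B n l                                    ≡⟨ n*B≡Tail+moment n l ⟩
    Tail n l + (suc l * B n (suc l) + l * B n l) <⟨ +-monoˡ-< _ (Tail<B increasing l l<n ≤-refl) ⟩
    B n (suc l) + (suc l * B n (suc l) + l * B n l) ≡⟨ solve 3 (λ x y l → x :+ ((con 1 :+ l) :* x :+ y) := y :+ (con 2 :+ l) :* x) refl (B n (suc l)) (l * B n l) l ⟩
    l * B n l + suc (suc l) * B n (suc l)        ∎)
    where
    l<n = l+1+r≡n⇒l<n l+1+r≡n

-- Ratio monotonicity from two-sided bounds

m*m<n*n⇒m<n : ∀ {m n} → m * m < n * n → m < n
m*m<n*n⇒m<n {m} {n} m*m<n*n with m <? n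
... | yes m<n = m<n
... | no  m≮n = contradiction m*m<n*n (≤⇒≯ (*-mono-≤ (≮⇒≥ m≮n) (≮⇒≥ m≮n)))

cross-< : ∀ α β {x y z w} → α * x < β * y → β * z < α * w → x * z < y * w
cross-< α β {x} {y} {z} {w} αx<βy βz<αw = *-cancelˡ-< (α * β) (x * z) (y * w)
  (subst₂ _<_ (solve 4 (λ a b x z → a :* x :* (b :* z) := a :* b :* (x :* z)) refl α β x z)
              (solve 4 (λ a b y w → b :* y :* (a :* w) := a :* b :* (y :* w)) refl α β y w)
              (*-mono-< αx<βy βz<αw))

n∸i≡1+[n∸1+i] : ∀ {i n} → i < n → n ∸ i ≡ suc (n ∸ suc i)
n∸i≡1+[n∸1+i] = +-∸-assoc 1

i+[1+n∸1+i]≡n : ∀ {i n} → i < n → i + suc (n ∸ suc i) ≡ n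
i+[1+n∸1+i]≡n {i} i<n = trans (+-suc i _) (m+[n∸m]≡n i<n)

suc[m∸1]≡m : ∀ {m} → 0 < m → suc (m ∸ 1) ≡ m
suc[m∸1]≡m {suc m} _ = refl

m≡2[m/2]⊎m≡1+2[m/2] : ∀ m → m ≡ m / 2 + m / 2 ⊎ m ≡ suc (m / 2 + m / 2)
m≡2[m/2]⊎m≡1+2[m/2] m with m % 2 | m%n<n m 2 | m≡m%n+[m/n]*n m 2
... | 0 | _ | m≡0+[m/2]*2 = inj₁ (trans m≡0+[m/2]*2 (solve 1 (λ h → h :* con 2 := h :+ h) refl (m / 2)))
... | 1 | _ | m≡1+[m/2]*2 = inj₂ (trans m≡1+[m/2]*2 (solve 1 (λ h → con 1 :+ h :* con 2 := con 1 :+ (h :+ h)) refl (m / 2)))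
... | suc (suc _) | s≤s (s≤s ()) | _

module CrossRatios (m : ℕ) (b : ℕ → ℕ)
  (lower : ∀ l r → l + suc r ≡ m → suc l * b (suc l) < suc r * b l)
  (upper : ∀ l r → l + suc r ≡ m → suc r * b l < suc (suc l) * b (suc l)) where

  cross-up : ∀ i j → i + suc (suc j) ≡ m → b i * b j < b (suc i) * b (suc j)
  cross-up i j i+2+j≡m = cross-< (suc (suc j)) (suc (suc i)) {b i} {b (suc i)} (upper i (suc j) i+2+j≡m) (upper j (suc i) j+2+i≡m)
    where
    j+2+i≡m : j + suc (suc i) ≡ m
    j+2+i≡m = trans (solve 2 (λ i j → j :+ (con 2 :+ i) := i :+ (con 2 :+ j)) refl i j) i+2+j≡m

  cross-down : ∀ i j → i + suc j ≡ m → b (suc j) * b (suc i) < b j * b i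
  cross-down i j i+1+j≡m = cross-< (suc j) (suc i) {b (suc j)} {b j} (lower j i j+1+i≡m) (lower i j i+1+j≡m)
    where
    j+1+i≡m : j + suc i ≡ m
    j+1+i≡m = trans (solve 2 (λ i j → j :+ (con 1 :+ i) := i :+ (con 1 :+ j)) refl i j) i+1+j≡m

  chain₁ : ∀ i → suc (suc i) ≤ m → b i * b (m ∸ 1 ∸ suc i) < b (suc i) * b (m ∸ 1 ∸ i)
  chain₁ i i+2≤m rewrite ∸-+-assoc m 1 i | ∸-+-assoc m 1 (suc i) | n∸i≡1+[n∸1+i] i+2≤m =
    cross-up i (m ∸ suc (suc i)) (trans (+-suc i _) (i+[1+n∸1+i]≡n i+2≤m))

  chain₂ : ∀ i → i < m → b (m ∸ i) * b (suc i) < b (m ∸ suc i) * b i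
  chain₂ i i<m rewrite n∸i≡1+[n∸1+i] i<m = cross-down i (m ∸ suc i) (i+[1+n∸1+i]≡n i<m)

  last₁ : ∀ i → suc i ≡ m / 2 → b i < b (m ∸ 1 ∸ i)
  last₁ i 1+i≡m/2 with m≡2[m/2]⊎m≡1+2[m/2] m
  ... | inj₁ even = subst (λ k → b i < b k) (sym m-1-i≡1+i) (m*m<n*n⇒m<n (cross-up i i i+2+i≡m))
    where
    m≡ : m ≡ suc i + suc i
    m≡ = trans even (cong (λ h → h + h) (sym 1+i≡m/2))
    m-1-i≡1+i : m ∸ 1 ∸ i ≡ suc i
    m-1-i≡1+i = trans (cong (λ k → k ∸ 1 ∸ i) m≡) (m+n∸m≡n i (suc i))
    i+2+i≡m : i + suc (suc i) ≡ m
    i+2+i≡m = trans (+-suc i (suc i)) (sym m≡)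
  ... | inj₂ odd = subst (λ k → b i < b k) (sym m-1-i≡2+i)
                   (*-cancelˡ-< (b (suc i)) _ _ (subst (_< b (suc i) * b (suc (suc i))) (*-comm (b i) (b (suc i))) (cross-up i (suc i) i+3+i≡m)))
    where
    m≡ : m ≡ suc (suc i + suc i)
    m≡ = trans odd (cong (λ h → suc (h + h)) (sym 1+i≡m/2))
    i+3+i≡m : i + suc (suc (suc i)) ≡ m
    i+3+i≡m = sym (trans m≡ (solve 1 (λ i → con 1 :+ ((con 1 :+ i) :+ (con 1 :+ i)) := i :+ (con 3 :+ i)) refl i))
    m-1-i≡2+i : m ∸ 1 ∸ i ≡ suc (suc i)
    m-1-i≡2+i = trans (cong (λ k → k ∸ 1 ∸ i) m≡) (trans (cong (_∸ i) (sym (+-suc i (suc i)))) (m+n∸m≡n i (suc (suc i))))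

  last₂ : ∀ i → 0 < m → i ≡ (m ∸ 1) / 2 → b (m ∸ i) < b i
  last₂ i 0<m i≡[m-1]/2 with m≡2[m/2]⊎m≡1+2[m/2] (m ∸ 1)
  ... | inj₁ even = subst (λ k → b k < b i) (sym m-i≡1+i) (m*m<n*n⇒m<n (cross-down i i i+1+i≡m))
    where
    i+1+i≡m : i + suc i ≡ m
    i+1+i≡m = begin-equality
      i + suc i                         ≡⟨ +-suc i i ⟩
      suc (i + i)                       ≡⟨ cong (λ h → suc (h + h)) i≡[m-1]/2 ⟩
      suc ((m ∸ 1) / 2 + (m ∸ 1) / 2)   ≡⟨ cong suc even ⟨
      suc (m ∸ 1)                       ≡⟨ suc[m∸1]≡m 0<m ⟩
      m                                 ∎
    m-i≡1+i : m ∸ i ≡ suc i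
    m-i≡1+i = trans (cong (_∸ i) (sym i+1+i≡m)) (m+n∸m≡n i (suc i))
  ... | inj₂ odd = subst (λ k → b k < b i) (sym m-i≡2+i)
                   (*-cancelˡ-< (b (suc i)) _ _ (subst (_< b (suc i) * b i) (*-comm (b (suc (suc i))) (b (suc i))) (cross-down i (suc i) i+2+i≡m)))
    where
    i+2+i≡m : i + suc (suc i) ≡ m
    i+2+i≡m = begin-equality
      i + suc (suc i)                        ≡⟨ solve 1 (λ i → i :+ (con 2 :+ i) := con 2 :+ (i :+ i)) refl i ⟩
      suc (suc (i + i))                      ≡⟨ cong (λ h → suc (suc (h + h))) i≡[m-1]/2 ⟩
      suc (suc ((m ∸ 1) / 2 + (m ∸ 1) / 2))  ≡⟨ cong suc odd ⟨
      suc (m ∸ 1)                            ≡⟨ suc[m∸1]≡m 0<m ⟩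
      m                                      ∎
    m-i≡2+i : m ∸ i ≡ suc (suc i)
    m-i≡2+i = trans (cong (_∸ i) (sym i+2+i≡m)) (m+n∸m≡n i (suc (suc i)))

-- The Boros–Moll weights

[1+n]*2[1+n]C[1+n]≡2[1+2n]*2nCn : ∀ n → suc n * (2 * suc n C suc n) ≡ 2 * suc (2 * n) * (2 * n C n)
[1+n]*2[1+n]C[1+n]≡2[1+2n]*2nCn n = begin-equality
  suc n * (2 * suc n C suc n)             ≡⟨ cong (λ x → suc n * (x C suc n)) (*-suc 2 n) ⟩
  suc n * (suc (suc (2 * n)) C suc n)     ≡⟨ cong (suc n *_) (pascal (suc (2 * n)) n) ⟩
  suc n * (suc (2 * n) C n + S)           ≡⟨ cong (λ x → suc n * (x + S)) [1+2n]Cn≡S ⟩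
  suc n * (S + S)                         ≡⟨ solve 2 (λ n s → (con 1 :+ n) :* (s :+ s) := con 2 :* ((con 1 :+ n) :* s)) refl n S ⟩
  2 * (suc n * S)                         ≡⟨ cong (2 *_) ([1+k]*[1+n]C[1+k]≡[1+n]*nCk (2 * n) n) ⟩
  2 * (suc (2 * n) * (2 * n C n))         ≡⟨ *-assoc 2 (suc (2 * n)) _ ⟨
  2 * suc (2 * n) * (2 * n C n)           ∎
  where
  S = suc (2 * n) C suc n
  [1+2n]Cn≡S : suc (2 * n) C n ≡ S
  [1+2n]Cn≡S = trans (nCk≡nC[n∸k] (≤-trans (m≤m+n n _) (n≤1+n _))) (cong (suc (2 * n) C_) 1+2n∸n≡1+n)
    where
    1+2n∸n≡1+n : suc (2 * n) ∸ n ≡ suc n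
    1+2n∸n≡1+n = trans (cong (_∸ n) (solve 1 (λ n → con 1 :+ con 2 :* n := n :+ (con 1 :+ n)) refl n)) (m+n∸m≡n n (suc n))

bmWeight : ℕ → ℕ → ℕ
bmWeight m k = 2 ^ k * ((2 * m ∸ 2 * k) C (m ∸ k)) * ((m + k) C k)

bmWeight>0 : ∀ {m k} → k ≤ m → 0 < bmWeight m k
bmWeight>0 {m} {k} k≤m = *-mono-< (*-mono-< (m^n>0 2 k) (k≤n⇒nCk>0 m-k≤2m-2k)) (k≤n⇒nCk>0 (m≤n+m k m))
  where
  m-k≤2m-2k : m ∸ k ≤ 2 * m ∸ 2 * k
  m-k≤2m-2k rewrite sym (*-distribˡ-∸ 2 m k) = m≤m+n (m ∸ k) _

[1+2v][1+k]<[1+v][1+m+k] : ∀ {k v m} → k + suc v ≡ m → suc (2 * v) * suc k < suc v * suc (m + k)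
[1+2v][1+k]<[1+v][1+m+k] {k} {v} refl = begin-strict
  suc (2 * v) * suc k                                  <⟨ m<m+n _ (s≤s z≤n) ⟩
  suc (2 * v) * suc k + suc (v * v + v + k)            ≡⟨ solve 2 (λ k v → (con 1 :+ con 2 :* v) :* (con 1 :+ k) :+ (con 1 :+ (v :* v :+ v :+ k))
                                                                   := (con 1 :+ v) :* (con 1 :+ (k :+ (con 1 :+ v) :+ k))) refl k v ⟩
  suc v * suc (k + suc v + k)                          ∎

bmWeight-suc : ∀ {m k} → k < m → bmWeight m k < bmWeight m (suc k)
bmWeight-suc {m} {k} k<m
  rewrite sym (*-distribˡ-∸ 2 m k) | sym (*-distribˡ-∸ 2 m (suc k)) | n∸i≡1+[n∸1+i] k<m | +-suc m k
  = *-cancelˡ-< (suc v * suc k) _ _ (begin-strict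
    suc v * suc k * (2 ^ k * (2 * suc v C suc v) * N)       ≡⟨ solve 5 (λ v k p c n → (con 1 :+ v) :* (con 1 :+ k) :* (p :* c :* n)
                                                                          := p :* ((con 1 :+ k) :* n) :* ((con 1 :+ v) :* c)) refl v k (2 ^ k) (2 * suc v C suc v) N ⟩
    2 ^ k * (suc k * N) * (suc v * (2 * suc v C suc v))     ≡⟨ cong (2 ^ k * (suc k * N) *_) ([1+n]*2[1+n]C[1+n]≡2[1+2n]*2nCn v) ⟩
    2 ^ k * (suc k * N) * (2 * suc (2 * v) * (2 * v C v))   ≡⟨ solve 6 (λ v k p c n t → p :* ((con 1 :+ k) :* n) :* (con 2 :* t :* c)
                                                                          := con 2 :* p :* c :* n :* (t :* (con 1 :+ k))) refl v k (2 ^ k) (2 * v C v) N (suc (2 * v)) ⟩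
    X * (suc (2 * v) * suc k)                               <⟨ *-monoʳ-< X ([1+2v][1+k]<[1+v][1+m+k] (i+[1+n∸1+i]≡n k<m)) ⟩
    X * (suc v * suc (m + k))                               ≡⟨ solve 6 (λ v k p c n t → con 2 :* p :* c :* n :* ((con 1 :+ v) :* t)
                                                                          := (con 1 :+ v) :* (con 2 :* p :* c :* (t :* n))) refl v k (2 ^ k) (2 * v C v) N (suc (m + k)) ⟩
    suc v * (2 * 2 ^ k * (2 * v C v) * (suc (m + k) * N))   ≡⟨ cong (λ x → suc v * (2 * 2 ^ k * (2 * v C v) * x)) ([1+k]*[1+n]C[1+k]≡[1+n]*nCk (m + k) k) ⟨
    suc v * (2 * 2 ^ k * (2 * v C v) * (suc k * (suc (m + k) C suc k)))
                                                            ≡⟨ solve 5 (λ v k p c t → (con 1 :+ v) :* (con 2 :* p :* c :* ((con 1 :+ k) :* t))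
                                                                          := (con 1 :+ v) :* (con 1 :+ k) :* (con 2 :* p :* c :* t)) refl v k (2 ^ k) (2 * v C v) (suc (m + k) C suc k) ⟩
    suc v * suc k * (2 * 2 ^ k * (2 * v C v) * (suc (m + k) C suc k)) ∎)
  where
  v = m ∸ suc k
  N = (m + k) C k
  X = 2 * 2 ^ k * (2 * v C v) * N
  instance
    X≢0 : NonZero X
    X≢0 = >-nonZero (*-mono-< (*-mono-< (m^n>0 2 (suc k)) (k≤n⇒nCk>0 (m≤m+n v _))) (k≤n⇒nCk>0 (m≤n+m k m)))

open BinomialTransform using (B; lower-bound; upper-bound)

bmNum≡B : ∀ m i → bmNum m i ≡ B (bmWeight m) m i
bmNum≡B m i = sumFromTo≡∑ i m _ vanishes
  where
  vanishes : ∀ {k} → k < i → bmWeight m k * (k C i) ≡ 0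
  vanishes {k} k<i rewrite k>n⇒nCk≡0 k<i = *-zeroʳ (bmWeight m k)

bmNum>0 : ∀ {m i} → i ≤ m → 0 < bmNum m i
bmNum>0 {m} {i} i≤m rewrite bmNum≡B m i = ∑-pos (suc m) (s≤s i≤m) 0<term
  where
  0<term : 0 < bmWeight m i * (i C i)
  0<term rewrite nCn≡1 i | *-identityʳ (bmWeight m i) = bmWeight>0 i≤m

bmNum-lower : ∀ {m} l r → l + suc r ≡ m → suc l * bmNum m (suc l) < suc r * bmNum m l
bmNum-lower {m} l r l+1+r≡m rewrite bmNum≡B m (suc l) | bmNum≡B m l =
  lower-bound (bmWeight m) r l+1+r≡m (bmWeight>0 (<⇒≤ (l+1+r≡n⇒l<n l+1+r≡m)))

bmNum-upper : ∀ {m} l r → l + suc r ≡ m → suc r * bmNum m l < suc (suc l) * bmNum m (suc l)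
bmNum-upper {m} l r l+1+r≡m rewrite bmNum≡B m (suc l) | bmNum≡B m l =
  upper-bound (bmWeight m) r (strictlyIncreasing-by-steps bmWeight-suc) l+1+r≡m

theorem1p1 : (m : ℕ) → 2 ≤ m → StrictlyRatioMonotone m (d m)
theorem1p1 m 2≤m = d>0 , record
  { chain₁ = λ i i+2≤m/2 → ratio-<-ratio i (m ∸ 1 ∸ i) (suc i) (m ∸ 1 ∸ suc i) (d>0 _ (m-1-i≤m i)) (d>0 _ (m-1-i≤m (suc i)))
                             (chain₁ i (≤-trans i+2≤m/2 (m/n≤m m 2)))
  ; last₁  = λ i 1+i≡m/2 → ratio<1 i (m ∸ 1 ∸ i) (d>0 _ (m-1-i≤m i)) (last₁ i 1+i≡m/2)
  ; chain₂ = λ i i≤m 1+i≤m _ → ratio-<-ratio (m ∸ i) i (m ∸ suc i) (suc i) (d>0 i i≤m) (d>0 (suc i) 1+i≤m) (chain₂ i 1+i≤m)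
  ; last₂  = λ i i≤m i≡[m-1]/2 → ratio<1 (m ∸ i) i (d>0 i i≤m) (last₂ i (<⇒≤ 2≤m) i≡[m-1]/2)
  }
  where
  instance
    4^m≢0 : NonZero (2 ^ (2 * m))
    4^m≢0 = >-nonZero (m^n>0 2 (2 * m))
  open Fractions.FixedDenominator (bmNum m) (2 ^ (2 * m))
  open CrossRatios m (bmNum m) bmNum-lower bmNum-upper
  d>0 : AllPositive m (d m)
  d>0 i i≤m = a>0 i (bmNum>0 i≤m)
  m-1-i≤m : ∀ i → m ∸ 1 ∸ i ≤ m
  m-1-i≤m i = ≤-trans (m∸n≤m (m ∸ 1) i) (m∸n≤m m 1)
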